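{- Let $b=\langle b(i):i<\omega\rangle$ be a sequence of non-empty sets and $h^+\in\omega^\omega$ with $h^+(n)\geq1$ for all but finitely many $n$. Let $\langle I_n:n<\omega\rangle$ be the partition of $\omega$ into consecutive intervals with $|I_n|=h^+(n)$ for all $n<\omega$, and define $b^+(n):=\prod_{k\in I_n}b(k)$. Then $\mathbf{aLc}(b^+,h^+)\preceq_{\mathrm{T}}\mathbf{Ed}_b$.
   Context: A relational system is a triple $\langle X,Y,\sqsubset\rangle$; $\langle X,Y,\sqsubset\rangle\preceq_{\mathrm{T}}\langle X',Y',\sqsubset'\rangle$ means there are $\Psi_-:X\to X'$, $\Psi_+:Y'\to Y$ with $\Psi_-(x)\sqsubset'y'\Rightarrow x\sqsubset\Psi_+(y')$ for all $x\in X,y'\in Y'$. For a sequence $b$ of non-empty sets and $h\in\omega^\omega$: $\prod b=\prod_n b(n)$, $\mathcal{S}(b,h)=\prod_n[b(n)]^{\leq h(n)}$. $\mathbf{aLc}(b,h)=\langle\mathcal{S}(b,h),\prod b,R\rangle$ where $\varphi\,R\,y$ iff $y(n)\notin\varphi(n)$ for all but finitely many $n$. $\mathbf{Ed}_b=\langle\prod b,\prod b,R'\rangle$ where $x\,R'\,y$ iff $x(n)\neq y(n)$ for all but finitely many $n$ (i.e. $x,y$ are eventually different). -}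

module Defs where

open import Level using (0ℓ)
open import Data.Nat using (ℕ; zero; suc; _+_; _≤_)
open import Data.Fin using (Fin)
open import Data.Unit using (⊤)
open import Data.Product using (Σ; ∃; _×_; _,_)
open import Relation.Binary.PropositionalEquality using (_≡_; _≢_)
open import Relation.Nullary using (¬_)

record RelSys : Set₁ where
  constructor ⟨_,_,_⟩
  field
    X : Set
    Y : Set
    R : X → Y → Set

open RelSys public

_⪯T_ : RelSys → RelSys → Set
S ⪯T S' = Σ (X S → X S') λ Ψ₋ → Σ (Y S' → Y S) λ Ψ₊ →
  ∀ (x : X S) (y' : Y S') → R S' (Ψ₋ x) y' → R S x (Ψ₊ y')

Eventually : (ℕ → Set) → Set
Eventually P = ∃ λ N → ∀ n → N ≤ n → P n

Π : (ℕ → Set) → Set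
Π b = (n : ℕ) → b n

-- A subset of A of size ≤ h, given as an enumeration of length k ≤ h
-- (repetitions allowed); membership is being in the image.
record SmallSubset (A : Set) (h : ℕ) : Set where
  constructor small
  field
    size  : ℕ
    size≤ : size ≤ h
    elem  : Fin size → A

open SmallSubset public

_∈ₛ_ : {A : Set} {h : ℕ} → A → SmallSubset A h → Set
a ∈ₛ φ = ∃ λ (i : Fin (size φ)) → elem φ i ≡ a

𝒮 : (ℕ → Set) → (ℕ → ℕ) → Set
𝒮 b h = (n : ℕ) → SmallSubset (b n) (h n)

aLc : (ℕ → Set) → (ℕ → ℕ) → RelSys
aLc b h = ⟨ 𝒮 b h , Π b , (λ φ y → Eventually (λ n → ¬ (y n ∈ₛ φ n))) ⟩

Ed : (ℕ → Set) → RelSys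
Ed b = ⟨ Π b , Π b , (λ x y → Eventually (λ n → x n ≢ y n)) ⟩

-- Start of interval I_n: H(n) = Σ_{m<n} h(m); I_n = [H(n), H(n)+h(n)).
start : (ℕ → ℕ) → ℕ → ℕ
start h zero = 0
start h (suc n) = start h n + h n

Block : (ℕ → Set) → ℕ → ℕ → Set
Block b s zero = ⊤
Block b s (suc l) = b s × Block b (suc s) l

plus : (ℕ → Set) → (ℕ → ℕ) → ℕ → Set
plus b h n = Block b (start h n) (h n)

-- Split each y ∈ ∏ b into the blocks y↾I_n, so that ∏ b⁺ is ∏ b regrouped. Given a slalom
-- φ ∈ 𝒮(b⁺, h⁺), build x ∈ ∏ b which at the i-th point of I_n agrees with the i-th element
-- of φ(n) (this is possible because φ(n) has at most h⁺(n) = |I_n| elements). If y↾I_n is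
-- the i-th element of φ(n), then x and y agree at the i-th point of I_n; so when x and y are
-- eventually different, y↾I_n ∉ φ(n) for almost all n. Since h⁺(n) ≥ 1 almost always, the
-- intervals I_n cover ω and go to infinity, which is what makes x well defined and the last
-- step go through.
module Submission where

open import Defs
open import Data.Nat using (ℕ; zero; suc; _+_; _∸_; _≤_; _<_; _<?_; _≟_; z≤n; s≤s)
open import Data.Nat.Properties
open import Data.Fin using (Fin; toℕ; fromℕ<)
open import Data.Fin.Properties using (toℕ<n; fromℕ<-cong; fromℕ<-toℕ)
open import Data.Product using (∃; _×_; _,_; proj₁)
open import Data.Unit using (tt)
open import Data.Sum using (inj₁; inj₂)
open import Data.Empty using (⊥-elim)
import Data.Empty.Irrelevant as Irrelevant
open import Relation.Nullary using (¬_; yes; no; contradiction)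
open import Relation.Binary using (tri<; tri≈; tri>)
open import Relation.Binary.PropositionalEquality

s≤k⇒k≮s+0 : ∀ {s k} → s ≤ k → ¬ (k < s + 0)
s≤k⇒k≮s+0 {s} s≤k k<s+0 = <-irrefl refl (<-≤-trans k<s+0 (subst (_≤ _) (sym (+-identityʳ s)) s≤k))

module _ {b : ℕ → Set} where

  lookupBlock : ∀ {s} l → Block b s l → (k : ℕ) → .(s ≤ k) → .(k < s + l) → b k
  lookupBlock zero _ k s≤k k<s+0 = Irrelevant.⊥-elim (s≤k⇒k≮s+0 s≤k k<s+0)
  lookupBlock {s} (suc l) (a , c) k s≤k k<s+1+l with s ≟ k
  ... | yes refl = a
  ... | no s≢k   = lookupBlock l c k (≤∧≢⇒< s≤k s≢k) (subst (k <_) (+-suc s l) k<s+1+l)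

  slice : Π b → ∀ s l → Block b s l
  slice y s zero    = tt
  slice y s (suc l) = y s , slice y (suc s) l

  lookupBlock-slice : (y : Π b) → ∀ s l k .(s≤k : s ≤ k) .(k<s+l : k < s + l) →
                      lookupBlock l (slice y s l) k s≤k k<s+l ≡ y k
  lookupBlock-slice y s zero k s≤k k<s+0 = Irrelevant.⊥-elim (s≤k⇒k≮s+0 s≤k k<s+0)
  lookupBlock-slice y s (suc l) k s≤k k<s+1+l with s ≟ k
  ... | yes refl = refl
  ... | no _     = lookupBlock-slice y (suc s) l k _ _

module _ {h : ℕ → ℕ} where

  start-mono-≤ : ∀ {m n} → m ≤ n → start h m ≤ start h n
  start-mono-≤ {n = zero}  z≤n   = ≤-refl
  start-mono-≤ {n = suc n} m≤1+n with m≤n⇒m<n∨m≡n m≤1+n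
  ... | inj₁ (s≤s m≤n) = ≤-trans (start-mono-≤ m≤n) (m≤m+n _ _)
  ... | inj₂ refl      = ≤-refl

  Located : ℕ → Set
  Located k = ∃ λ n → start h n ≤ k × k < start h n + h n

  locate : ∀ {k} m → k < start h m → Located k
  locate {k} (suc m) k<start with k <? start h m
  ... | yes k<start′ = locate m k<start′
  ... | no  k≮start′ = m , ≮⇒≥ k≮start′ , k<start

  Located-unique : ∀ {k} (L L′ : Located k) → proj₁ L ≡ proj₁ L′
  Located-unique (m , m≤k , k<m) (n , n≤k , k<n) with <-cmp m n
  ... | tri< m<n _ _ = ⊥-elim (<-irrefl refl (<-≤-trans k<m (≤-trans (start-mono-≤ m<n) n≤k)))
  ... | tri≈ _ m≡n _ = m≡n
  ... | tri> _ _ n<m = ⊥-elim (<-irrefl refl (<-≤-trans k<n (≤-trans (start-mono-≤ n<m) m≤k)))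

  module _ {N : ℕ} (h≥1 : ∀ n → N ≤ n → 1 ≤ h n) where

    n≤N+start : ∀ n → n ≤ N + start h n
    n≤N+start zero    = z≤n
    n≤N+start (suc n) with n <? N
    ... | yes n<N = ≤-trans n<N (m≤m+n N _)
    ... | no  n≮N = begin
        suc n                   ≤⟨ s≤s (n≤N+start n) ⟩
        suc (N + start h n)     ≡⟨ sym (+-suc N _) ⟩
        N + suc (start h n)     ≡⟨ cong (N +_) (+-comm 1 _) ⟩
        N + (start h n + 1)     ≤⟨ +-monoʳ-≤ N (+-monoʳ-≤ (start h n) (h≥1 n (≮⇒≥ n≮N))) ⟩
        N + (start h (suc n))   ∎
      where open ≤-Reasoning hiding (start)

    locate-everywhere : ∀ k → Located k
    locate-everywhere k = locate (suc (N + k))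
      (+-cancelˡ-≤ N _ _ (subst (_≤ N + start h (suc (N + k))) (sym (+-suc N k)) (n≤N+start (suc (N + k)))))

  module _ {b : ℕ → Set} (default : Π b) (φ : 𝒮 (plus b h) h) where

    diagonal : ∀ k → Located k → b k
    diagonal k (n , s≤k , k<s+h) with k ∸ start h n <? size (φ n)
    ... | yes i<size = lookupBlock (h n) (elem (φ n) (fromℕ< i<size)) k s≤k k<s+h
    ... | no  _      = default k

    diagonal-elem : ∀ n (i : Fin (size (φ n))) (L : Located (start h n + toℕ i)) →
      let k = start h n + toℕ i in
      ∃ λ s≤k → ∃ λ k<s+h → diagonal k L ≡ lookupBlock (h n) (elem (φ n) i) k s≤k k<s+h
    diagonal-elem n i (n′ , s≤k , k<s+h) with Located-unique (n′ , s≤k , k<s+h) (n , m≤m+n _ _ , k<)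
      where
      k< : start h n + toℕ i < start h n + h n
      k< = +-monoʳ-< (start h n) (<-≤-trans (toℕ<n i) (size≤ (φ n)))
    ... | refl with start h n + toℕ i ∸ start h n <? size (φ n)
    ...   | no  i≮size = contradiction (subst (_< size (φ n)) (sym offset) (toℕ<n i)) i≮size
      where
      offset : start h n + toℕ i ∸ start h n ≡ toℕ i
      offset = m+n∸m≡n (start h n) (toℕ i)
    ...   | yes i<size = s≤k , k<s+h , cong (λ j → lookupBlock (h n) (elem (φ n) j) _ s≤k k<s+h) fromℕ<≡i
      where
      fromℕ<≡i : fromℕ< i<size ≡ i
      fromℕ<≡i = trans (fromℕ<-cong _ _ (m+n∸m≡n (start h n) (toℕ i)) i<size (toℕ<n i))
                       (fromℕ<-toℕ i (toℕ<n i))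

lemma3p15 : (b : ℕ → Set) → ((i : ℕ) → b i) → (h⁺ : ℕ → ℕ) →
    Eventually (λ n → 1 ≤ h⁺ n) →
    aLc (plus b h⁺) h⁺ ⪯T Ed b
lemma3p15 b default h (N , h≥1) = Ψ₋ , Ψ₊ , reduction
  where
  Ψ₋ : 𝒮 (plus b h) h → Π b
  Ψ₋ φ k = diagonal default φ k (locate-everywhere h≥1 k)

  Ψ₊ : Π b → Π (plus b h)
  Ψ₊ y n = slice y (start h n) (h n)

  reduction : ∀ φ y → Eventually (λ k → Ψ₋ φ k ≢ y k) → Eventually (λ n → ¬ (Ψ₊ y n ∈ₛ φ n))
  reduction φ y (M , differ) = N + M , λ n N+M≤n (i , φni≡y↾Iₙ) →
    let k = start h n + toℕ i
        M≤k = ≤-trans (+-cancelˡ-≤ N M _ (≤-trans N+M≤n (n≤N+start h≥1 n))) (m≤m+n _ _)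
        (s≤k , k<s+h , Ψ₋φk≡) = diagonal-elem default φ n i (locate-everywhere h≥1 k)
    in differ k M≤k (begin
         Ψ₋ φ k                                                      ≡⟨ Ψ₋φk≡ ⟩
         lookupBlock (h n) (elem (φ n) i) k s≤k k<s+h                ≡⟨ cong (λ c → lookupBlock (h n) c k s≤k k<s+h) φni≡y↾Iₙ ⟩
         lookupBlock (h n) (slice y (start h n) (h n)) k s≤k k<s+h   ≡⟨ lookupBlock-slice y (start h n) (h n) k s≤k k<s+h ⟩
         y k                                                         ∎)
    where open ≡-Reasoning
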